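{- Let $D$ be a diagram that contains no ghost cells and let $T\in GKD(D)$. Then: (a) $S(D)\subset T$. (b) If $(\hat r,c)\in R(T)$ and $(\tilde r,c)\in T$ is an ordinary cell with $\tilde r\le\hat r$, then $(\tilde r,c)\notin S(D)$. (c) For every $r>0$, $\mathcal{G}(f_D(T),r)=f_D(\mathcal{G}(T,r))$.
   Context: A diagram is a finite set of cells at positions $(r,c)$ with $r,c$ positive integers ($r$ = row from the bottom, $c$ = column), at most one cell per position; each cell is either ordinary, written $(r,c)$, or a ghost cell, written $\langle r,c\rangle$. A position is empty if it contains no cell. Ghost move $\mathcal{G}(D,r)$ at row $r$ of $D$: let the rightmost cell of row $r$ (ghost or not) lie in column $c$. The move does nothing (so $\mathcal{G}(D,r)=D$) if there is no such cell, that cell is a ghost cell, every position $(r',c)$ with $r'<r$ is occupied, or, letting $\hat r<r$ be maximal with $(\hat r,c)$ empty, some $(r^*,c)$ with $\hat r<r^*<r$ holds a ghost cell. Otherwise it moves the cell from $(r,c)$ to $(\hat r,c)$ and places a ghost cell $\langle r,c\rangle$ at $(r,c)$. $GKD(D)$ is the set of $D$ and all diagrams obtained from $D$ by finite sequences of ghost moves. $R(D)$ is the set of ordinary cells $(r,c)\in D$ such that no cell (ordinary or ghost) of $D$ lies at $(r,\tilde c)$ with $\tilde c>c$. $S(D)=\{(r,c)\in D \text{ ordinary}: (r,c)\notin R(D) \text{ and } (r^*,c)\notin R(D)\ \forall r^*>r\}$, and $f_D(\tilde D)=\tilde D\setminus S(D)$ for $\tilde D\in GKD(D)$. -}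

module Defs where

open import Data.Nat using (ℕ; zero; suc; _<_; _≤_; _∸_; _≤ᵇ_; _<ᵇ_; _≡ᵇ_)
open import Data.Bool using (Bool; true; false; if_then_else_; _∧_; _∨_; not)
open import Data.Maybe using (Maybe; just; nothing)
open import Data.Product using (_×_)
open import Relation.Binary.PropositionalEquality using (_≡_)
open import Relation.Nullary using (¬_)

data Cell : Set where
  emp ord gho : Cell

isEmp : Cell → Bool
isEmp emp = true
isEmp _   = false

isOrd : Cell → Bool
isOrd ord = true
isOrd _   = false

isGho : Cell → Bool
isGho gho = true
isGho _   = false

-- A diagram is given by a bound n and a raw filling; its cells are the
-- non-empty positions (r,c) with 1 ≤ r ≤ n and 1 ≤ c ≤ n.  Every finite
-- diagram (positions r,c ≥ 1) arises this way and each such data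
-- determines a finite diagram; "at most one cell per position" is built in.
record Diagram : Set where
  constructor mkDiagram
  field
    bound : ℕ
    raw   : ℕ → ℕ → Cell
open Diagram public

inBox : ℕ → ℕ → ℕ → Bool
inBox n r c = (1 ≤ᵇ r) ∧ (r ≤ᵇ n) ∧ (1 ≤ᵇ c) ∧ (c ≤ᵇ n)

cell : Diagram → ℕ → ℕ → Cell
cell D r c = if inBox (bound D) r c then raw D r c else emp

_≈D_ : Diagram → Diagram → Set
D ≈D E = ∀ r c → cell D r c ≡ cell E r c

maxUpTo : (ℕ → Bool) → ℕ → Maybe ℕ
maxUpTo p zero    = nothing
maxUpTo p (suc m) = if p (suc m) then just (suc m) else maxUpTo p m

anyUpTo : (ℕ → Bool) → ℕ → Bool
anyUpTo p zero    = false
anyUpTo p (suc m) = p (suc m) ∨ anyUpTo p m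

rightmostCol : Diagram → ℕ → Maybe ℕ
rightmostCol D r = maxUpTo (λ c → not (isEmp (cell D r c))) (bound D)

hatRow : Diagram → ℕ → ℕ → Maybe ℕ
hatRow D r c = maxUpTo (λ r' → isEmp (cell D r' c)) (r ∸ 1)

ghostBetween : Diagram → ℕ → ℕ → ℕ → Bool
ghostBetween D lo hi c =
  anyUpTo (λ r* → (lo <ᵇ r*) ∧ isGho (cell D r* c)) (hi ∸ 1)

moveCell : Diagram → ℕ → ℕ → ℕ → Diagram
moveCell D r c h = mkDiagram (bound D) λ x y →
  if (x ≡ᵇ h) ∧ (y ≡ᵇ c) then ord
  else if (x ≡ᵇ r) ∧ (y ≡ᵇ c) then gho
  else cell D x y

ghostAt : Diagram → ℕ → ℕ → Maybe ℕ → Diagram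
ghostAt D r c nothing  = D
ghostAt D r c (just h) =
  if ghostBetween D h r c then D else moveCell D r c h

ghostCol : Diagram → ℕ → Maybe ℕ → Diagram
ghostCol D r nothing  = D
ghostCol D r (just c) =
  if isGho (cell D r c) then D else ghostAt D r c (hatRow D r c)

G : Diagram → ℕ → Diagram
G D r = ghostCol D r (rightmostCol D r)

data GKD (D : Diagram) : Diagram → Set where
  gkd-base : GKD D D
  gkd-step : ∀ {T} → GKD D T → (r : ℕ) → GKD D (G T r)

InR : Diagram → ℕ → ℕ → Set
InR D r c = (cell D r c ≡ ord) × (∀ c' → c < c' → cell D r c' ≡ emp)

InS : Diagram → ℕ → ℕ → Set
InS D r c = (cell D r c ≡ ord) × (¬ InR D r c) × (∀ r* → r < r* → ¬ InR D r* c)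

-- boolean versions (bounded searches; cells beyond the bound are empty)
inRᵇ : Diagram → ℕ → ℕ → Bool
inRᵇ D r c = isOrd (cell D r c)
  ∧ not (anyUpTo (λ c' → (c <ᵇ c') ∧ not (isEmp (cell D r c'))) (bound D))

inSᵇ : Diagram → ℕ → ℕ → Bool
inSᵇ D r c = isOrd (cell D r c) ∧ not (inRᵇ D r c)
  ∧ not (anyUpTo (λ r* → (r <ᵇ r*) ∧ inRᵇ D r* c) (bound D))

f : Diagram → Diagram → Diagram
f D T = mkDiagram (bound T) λ r c → if inSᵇ D r c then emp else cell T r c

NoGhosts : Diagram → Set
NoGhosts D = ∀ r c → ¬ (cell D r c ≡ gho)

{-# OPTIONS --safe #-}
-- Every T ∈ GKD(D) satisfies three invariants: positions occupied in D stay occupied, ordinary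
-- cells of D outside R(D) never move, and every ordinary cell of T that is not a cell of D lies
-- at or below a cell of R(D) in its column.  Consequently every cell of R(T) lies at or below a
-- cell of R(D) in its column, whereas a cell of S(D) lies strictly above all cells of R(D) in its
-- column; this gives (b), and (a) is the second invariant.  A ghost move at row r is determined
-- by the rightmost cell of that row, which removing S(D) leaves in place, and, if that cell is
-- ordinary, by the cells under it in its column; it changes only two of these cells, and none of
-- them lies in S(D).  Hence removing S(D) commutes with the move.
module Submission where

open import Defs
open import Data.Bool using (Bool; true; false; not; _∧_; _∨_; if_then_else_)
open import Data.Bool.Properties using (T-≡; T-∧; ∧-zeroʳ; ∨-zeroʳ; not-injective)
open import Data.Empty using (⊥-elim)
open import Data.Maybe using (Maybe; just; nothing)
open import Data.Nat using (ℕ; zero; suc; _≤_; _<_; _∸_; _≡ᵇ_; _<ᵇ_; _≟_; _≤?_; s≤s; z≤n)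
open import Data.Nat.Properties
  using (≤-refl; ≤-trans; <⇒≤; <⇒≱; <-irrefl; ≰⇒>; ≤-pred; m≤n⇒m≤1+n; m≤n⇒m<n∨m≡n; m∸n≤m;
         ≤ᵇ⇒≤; ≤⇒≤ᵇ; <ᵇ⇒<; <⇒<ᵇ; ≡ᵇ⇒≡; ≡⇒≡ᵇ)
open import Data.Product using (_×_; _,_; proj₁; proj₂; ∃-syntax)
open import Data.Product.Properties using (≡-dec)
open import Data.Sum using (inj₁; inj₂)
open import Function.Bundles using (Equivalence)
open import Relation.Binary.Definitions using (DecidableEquality)
open import Relation.Binary.PropositionalEquality
  using (_≡_; _≢_; refl; sym; trans; cong; cong₂; module ≡-Reasoning)
open import Relation.Nullary using (¬_; Dec; yes; no)

open Equivalence using (to; from)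

maxUpTo-just : ∀ p m {k} → maxUpTo p m ≡ just k →
  p k ≡ true × 1 ≤ k × k ≤ m × (∀ j → k < j → j ≤ m → p j ≡ false)
maxUpTo-just p (suc m) {k} e with p (suc m) in p[1+m]
maxUpTo-just p (suc m) refl | true =
  p[1+m] , s≤s z≤n , ≤-refl , λ j k<j j≤k → ⊥-elim (<⇒≱ k<j j≤k)
... | false with maxUpTo-just p m e
... | pk , 1≤k , k≤m , above = pk , 1≤k , m≤n⇒m≤1+n k≤m , above′
  where
  above′ : ∀ j → k < j → j ≤ suc m → p j ≡ false
  above′ j k<j j≤1+m with m≤n⇒m<n∨m≡n j≤1+m
  ... | inj₁ j<1+m = above j k<j (≤-pred j<1+m)
  ... | inj₂ refl  = p[1+m]

maxUpTo-cong : ∀ p q m → (∀ j → j ≤ m → p j ≡ q j) → maxUpTo p m ≡ maxUpTo q m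
maxUpTo-cong p q zero    p≗q = refl
maxUpTo-cong p q (suc m) p≗q rewrite p≗q (suc m) ≤-refl with q (suc m)
... | true  = refl
... | false = maxUpTo-cong p q m λ j j≤m → p≗q j (m≤n⇒m≤1+n j≤m)

maxUpTo-sub : ∀ p q m → (∀ j → q j ≡ true → p j ≡ true) →
  (∀ k → maxUpTo p m ≡ just k → q k ≡ true) → maxUpTo q m ≡ maxUpTo p m
maxUpTo-sub p q zero    q⊆p top = refl
maxUpTo-sub p q (suc m) q⊆p top with p (suc m) in p[1+m]
... | true  rewrite top (suc m) refl = refl
... | false with q (suc m) in q[1+m]
...   | true  with () ← trans (sym p[1+m]) (q⊆p (suc m) q[1+m])
...   | false = maxUpTo-sub p q m q⊆p top

anyUpTo-cong : ∀ p q m → (∀ j → j ≤ m → p j ≡ q j) → anyUpTo p m ≡ anyUpTo q m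
anyUpTo-cong p q zero    p≗q = refl
anyUpTo-cong p q (suc m) p≗q =
  cong₂ _∨_ (p≗q (suc m) ≤-refl) (anyUpTo-cong p q m λ j j≤m → p≗q j (m≤n⇒m≤1+n j≤m))

anyUpTo-witness : ∀ p m {j} → 1 ≤ j → j ≤ m → p j ≡ true → anyUpTo p m ≡ true
anyUpTo-witness p zero    1≤j j≤0 pj = ⊥-elim (<⇒≱ 1≤j j≤0)
anyUpTo-witness p (suc m) 1≤j j≤1+m pj with m≤n⇒m<n∨m≡n j≤1+m
... | inj₂ refl rewrite pj = refl
... | inj₁ j<1+m rewrite anyUpTo-witness p m 1≤j (≤-pred j<1+m) pj = ∨-zeroʳ (p (suc m))

anyUpTo-none : ∀ p m → (∀ j → j ≤ m → p j ≡ false) → anyUpTo p m ≡ false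
anyUpTo-none p zero    none = refl
anyUpTo-none p (suc m) none
  rewrite none (suc m) ≤-refl = anyUpTo-none p m λ j j≤m → none j (m≤n⇒m≤1+n j≤m)

≟ord : (x : Cell) → Dec (x ≡ ord)
≟ord emp = no λ ()
≟ord ord = yes refl
≟ord gho = no λ ()

≟emp : (x : Cell) → Dec (x ≡ emp)
≟emp emp = yes refl
≟emp ord = no λ ()
≟emp gho = no λ ()

≡ord⇒≢emp : ∀ {x} → x ≡ ord → x ≢ emp
≡ord⇒≢emp refl ()

≡gho⇒≢emp : ∀ {x} → x ≡ gho → x ≢ emp
≡gho⇒≢emp refl ()

isEmp⇒≡emp : ∀ {x} → isEmp x ≡ true → x ≡ emp
isEmp⇒≡emp {emp} _ = refl

¬isEmp⇒≢emp : ∀ {x} → isEmp x ≡ false → x ≢ emp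
¬isEmp⇒≢emp {emp} ()

≢ord⇒¬isOrd : ∀ {x} → x ≢ ord → isOrd x ≡ false
≢ord⇒¬isOrd {emp} _      = refl
≢ord⇒¬isOrd {ord} notOrd = ⊥-elim (notOrd refl)
≢ord⇒¬isOrd {gho} _      = refl

nonempty∧¬isGho⇒≡ord : ∀ {x} → x ≢ emp → isGho x ≡ false → x ≡ ord
nonempty∧¬isGho⇒≡ord {emp} occupied _ = ⊥-elim (occupied refl)
nonempty∧¬isGho⇒≡ord {ord} _        _ = refl

inBox-bounds : ∀ n r c → inBox n r c ≡ true → 1 ≤ r × r ≤ n × 1 ≤ c × c ≤ n
inBox-bounds n r c e with to T-∧ (from T-≡ e)
... | 1≤r , rest with to T-∧ rest
... | r≤n , rest′ with to T-∧ rest′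
... | 1≤c , c≤n = ≤ᵇ⇒≤ 1 r 1≤r , ≤ᵇ⇒≤ r n r≤n , ≤ᵇ⇒≤ 1 c 1≤c , ≤ᵇ⇒≤ c n c≤n

bounds-inBox : ∀ {n r c} → 1 ≤ r → r ≤ n → 1 ≤ c → c ≤ n → inBox n r c ≡ true
bounds-inBox 1≤r r≤n 1≤c c≤n = to T-≡ (from T-∧ (≤⇒≤ᵇ 1≤r ,
  from T-∧ (≤⇒≤ᵇ r≤n , from T-∧ (≤⇒≤ᵇ 1≤c , ≤⇒≤ᵇ c≤n))))

nonempty⇒inBox : ∀ D {r c} → cell D r c ≢ emp → inBox (bound D) r c ≡ true
nonempty⇒inBox D {r} {c} occupied with inBox (bound D) r c
... | true  = refl
... | false = ⊥-elim (occupied refl)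

cell-bounds : ∀ D {r c} → cell D r c ≢ emp → 1 ≤ r × r ≤ bound D × 1 ≤ c × c ≤ bound D
cell-bounds D {r} {c} occupied = inBox-bounds (bound D) r c (nonempty⇒inBox D occupied)

cell-beyond : ∀ D r c → bound D < c → cell D r c ≡ emp
cell-beyond D r c n<c with inBox (bound D) r c in inside
... | false = refl
... | true  = ⊥-elim (<⇒≱ n<c (proj₂ (proj₂ (proj₂ (inBox-bounds (bound D) r c inside)))))

_≟₂_ : DecidableEquality (ℕ × ℕ)
_≟₂_ = ≡-dec _≟_ _≟_

samePos-refl : ∀ x y → ((x ≡ᵇ x) ∧ (y ≡ᵇ y)) ≡ true
samePos-refl x y rewrite to T-≡ (≡⇒≡ᵇ x x refl) | to T-≡ (≡⇒≡ᵇ y y refl) = refl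

samePos-≢ : ∀ {x y h c} → (x , y) ≢ (h , c) → ((x ≡ᵇ h) ∧ (y ≡ᵇ c)) ≡ false
samePos-≢ {x} {y} {h} {c} ne with x ≡ᵇ h in x≡ᵇh | y ≡ᵇ c in y≡ᵇc
... | false | _     = refl
... | true  | false = refl
... | true  | true  with refl ← ≡ᵇ⇒≡ x h (from T-≡ x≡ᵇh) | refl ← ≡ᵇ⇒≡ y c (from T-≡ y≡ᵇc)
  = ⊥-elim (ne refl)

moveCell-target : ∀ T r c h → inBox (bound T) h c ≡ true → cell (moveCell T r c h) h c ≡ ord
moveCell-target T r c h inside rewrite inside | samePos-refl h c = refl

moveCell-source : ∀ T r c h → (r , c) ≢ (h , c) → inBox (bound T) r c ≡ true →
  cell (moveCell T r c h) r c ≡ gho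
moveCell-source T r c h r≢h inside rewrite inside | samePos-≢ r≢h | samePos-refl r c = refl

moveCell-elsewhere : ∀ T r c h x y → (x , y) ≢ (h , c) → (x , y) ≢ (r , c) →
  cell (moveCell T r c h) x y ≡ cell T x y
moveCell-elsewhere T r c h x y ≢target ≢source with inBox (bound T) x y
... | false = refl
... | true rewrite samePos-≢ ≢target | samePos-≢ ≢source = refl

EmptyRightOf : Diagram → ℕ → ℕ → Set
EmptyRightOf D r c = ∀ c' → c < c' → cell D r c' ≡ emp

rightmostCol-just : ∀ T r {c} → rightmostCol T r ≡ just c → cell T r c ≢ emp × EmptyRightOf T r c
rightmostCol-just T r {c} e with maxUpTo-just (λ c → not (isEmp (cell T r c))) (bound T) e
... | occupied , _ , _ , noneAbove = ¬isEmp⇒≢emp (not-injective occupied) , emptyRight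
  where
  emptyRight : EmptyRightOf T r c
  emptyRight c' c<c' with c' ≤? bound T
  ... | yes c'≤n = isEmp⇒≡emp (not-injective (noneAbove c' c<c' c'≤n))
  ... | no  c'≰n = cell-beyond T r c' (≰⇒> c'≰n)

rightmost-InR : ∀ T r {c} → rightmostCol T r ≡ just c → isGho (cell T r c) ≡ false → InR T r c
rightmost-InR T r rc notGho with occupied , emptyRight ← rightmostCol-just T r rc =
  nonempty∧¬isGho⇒≡ord occupied notGho , emptyRight

hatRow-just : ∀ T r c {h} → hatRow T r c ≡ just h → 1 ≤ h × h < r
hatRow-just T (suc r) c e with _ , 1≤h , h≤r , _ ← maxUpTo-just (λ r' → isEmp (cell T r' c)) r e =
  1≤h , s≤s h≤r

hatRow-local : ∀ U T r c → (∀ j → j ≤ r → cell U j c ≡ cell T j c) → hatRow U r c ≡ hatRow T r c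
hatRow-local U T r c agree =
  maxUpTo-cong _ _ (r ∸ 1) λ j j≤r∸1 → cong isEmp (agree j (≤-trans j≤r∸1 (m∸n≤m r 1)))

ghostBetween-local : ∀ U T h r c → (∀ j → j ≤ r → cell U j c ≡ cell T j c) →
  ghostBetween U h r c ≡ ghostBetween T h r c
ghostBetween-local U T h r c agree = anyUpTo-cong _ _ (r ∸ 1) λ j j≤r∸1 →
  cong (λ x → (h <ᵇ j) ∧ isGho x) (agree j (≤-trans j≤r∸1 (m∸n≤m r 1)))

-- just (c , h) means: the move carries the cell at (r , c) down to (h , c).
targetAt : Diagram → ℕ → ℕ → Maybe ℕ → Maybe (ℕ × ℕ)
targetAt T r c nothing  = nothing
targetAt T r c (just h) = if ghostBetween T h r c then nothing else just (c , h)

targetIn : Diagram → ℕ → Maybe ℕ → Maybe (ℕ × ℕ)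
targetIn T r nothing  = nothing
targetIn T r (just c) = if isGho (cell T r c) then nothing else targetAt T r c (hatRow T r c)

moveTarget : Diagram → ℕ → Maybe (ℕ × ℕ)
moveTarget T r = targetIn T r (rightmostCol T r)

applyMove : Diagram → ℕ → Maybe (ℕ × ℕ) → Diagram
applyMove T r nothing        = T
applyMove T r (just (c , h)) = moveCell T r c h

G≡applyMove : ∀ T r → G T r ≡ applyMove T r (moveTarget T r)
G≡applyMove T r = inColumn (rightmostCol T r)
  where
  atRow : ∀ c mh → ghostAt T r c mh ≡ applyMove T r (targetAt T r c mh)
  atRow c nothing = refl
  atRow c (just h) with ghostBetween T h r c
  ... | true  = refl
  ... | false = refl
  inColumn : ∀ mc → ghostCol T r mc ≡ applyMove T r (targetIn T r mc)
  inColumn nothing = refl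
  inColumn (just c) with isGho (cell T r c)
  ... | true  = refl
  ... | false = atRow c (hatRow T r c)

moveTarget-just : ∀ T r {c h} → moveTarget T r ≡ just (c , h) → InR T r c × 1 ≤ h × h < r
moveTarget-just T r e with rightmostCol T r in rc
... | just c with isGho (cell T r c) in notGho
...   | false with hatRow T r c in hr
...     | just h with ghostBetween T h r c
...       | false with refl ← e = rightmost-InR T r rc notGho , hatRow-just T r c hr

targetAt-local : ∀ U T r c → (∀ j → j ≤ r → cell U j c ≡ cell T j c) →
  targetAt U r c (hatRow U r c) ≡ targetAt T r c (hatRow T r c)
targetAt-local U T r c agree rewrite hatRow-local U T r c agree with hatRow T r c
... | nothing = refl
... | just h rewrite ghostBetween-local U T h r c agree = refl

UnderR : Diagram → ℕ → ℕ → Set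
UnderR D r c = ∃[ r₀ ] r ≤ r₀ × InR D r₀ c

UnderR-mono : ∀ {D r r' c} → r' ≤ r → UnderR D r c → UnderR D r' c
UnderR-mono r'≤r (r₀ , r≤r₀ , inR) = r₀ , ≤-trans r'≤r r≤r₀ , inR

UnderR⇒¬InS : ∀ {D r c} → UnderR D r c → ¬ InS D r c
UnderR⇒¬InS (r₀ , r≤r₀ , inR) (_ , ∉R , noneAbove) with m≤n⇒m<n∨m≡n r≤r₀
... | inj₁ r<r₀ = noneAbove r₀ r<r₀ inR
... | inj₂ refl = ∉R inR

InR⇒inRᵇ : ∀ D r c → InR D r c → inRᵇ D r c ≡ true
InR⇒inRᵇ D r c (isOrd , emptyRight) rewrite isOrd = cong not (anyUpTo-none _ (bound D) noCellRight)
  where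
  noCellRight : ∀ c' → c' ≤ bound D → ((c <ᵇ c') ∧ not (isEmp (cell D r c'))) ≡ false
  noCellRight c' _ with c <ᵇ c' in c<ᵇc'
  ... | false = refl
  ... | true rewrite emptyRight c' (<ᵇ⇒< c c' (from T-≡ c<ᵇc')) = refl

inRᵇ⇒¬inSᵇ : ∀ D r c → inRᵇ D r c ≡ true → inSᵇ D r c ≡ false
inRᵇ⇒¬inSᵇ D r c inR rewrite inR = ∧-zeroʳ (isOrd (cell D r c))

inRᵇ-above⇒¬inSᵇ : ∀ D r c → anyUpTo (λ r* → (r <ᵇ r*) ∧ inRᵇ D r* c) (bound D) ≡ true →
  inSᵇ D r c ≡ false
inRᵇ-above⇒¬inSᵇ D r c above rewrite above | ∧-zeroʳ (not (inRᵇ D r c)) = ∧-zeroʳ (isOrd (cell D r c))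

UnderR⇒¬inSᵇ : ∀ {D r c} → UnderR D r c → inSᵇ D r c ≡ false
UnderR⇒¬inSᵇ {D} {r} {c} (r₀ , r≤r₀ , inR) with m≤n⇒m<n∨m≡n r≤r₀
... | inj₂ refl = inRᵇ⇒¬inSᵇ D r c (InR⇒inRᵇ D r c inR)
... | inj₁ r<r₀ with 1≤r₀ , r₀≤n , _ ← cell-bounds D (≡ord⇒≢emp (proj₁ inR)) =
  inRᵇ-above⇒¬inSᵇ D r c (anyUpTo-witness _ (bound D) 1≤r₀ r₀≤n
    (trans (cong (_∧ inRᵇ D r₀ c) (to T-≡ (<⇒<ᵇ r<r₀))) (InR⇒inRᵇ D r₀ c inR)))

≢ord⇒¬inSᵇ : ∀ D r c → cell D r c ≢ ord → inSᵇ D r c ≡ false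
≢ord⇒¬inSᵇ D r c notOrd rewrite ≢ord⇒¬isOrd notOrd = refl

f-keeps : ∀ D T x y → inSᵇ D x y ≡ false → cell (f D T) x y ≡ cell T x y
f-keeps D T x y notS with inBox (bound T) x y
... | false = refl
... | true rewrite notS = refl

f-nonempty : ∀ D T x y → not (isEmp (cell (f D T) x y)) ≡ true → not (isEmp (cell T x y)) ≡ true
f-nonempty D T x y with inBox (bound T) x y | inSᵇ D x y
... | false | _     = λ ()
... | true  | true  = λ ()
... | true  | false = λ occupied → occupied

moveCell-f : ∀ D T r c h → inSᵇ D h c ≡ false → inSᵇ D r c ≡ false →
  moveCell (f D T) r c h ≈D f D (moveCell T r c h)
moveCell-f D T r c h target∉S source∉S x y with (x , y) ≟₂ (h , c) | (x , y) ≟₂ (r , c)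
... | yes refl | _ rewrite target∉S | samePos-refl h c with inBox (bound T) h c
...   | true  = refl
...   | false = refl
moveCell-f D T r c h target∉S source∉S x y | no ≢target | yes refl
  rewrite source∉S | samePos-≢ ≢target | samePos-refl r c with inBox (bound T) r c
...   | true  = refl
...   | false = refl
moveCell-f D T r c h target∉S source∉S x y | no ≢target | no ≢source
  rewrite moveCell-elsewhere (f D T) r c h x y ≢target ≢source
        | moveCell-elsewhere T r c h x y ≢target ≢source = refl

record Invariant (D T : Diagram) : Set where
  field
    stays-occupied : ∀ r c → cell D r c ≢ emp → cell T r c ≢ emp
    new-under-R    : ∀ r c → cell T r c ≡ ord → cell D r c ≢ ord → UnderR D r c
    fixed-off-R    : ∀ r c → cell D r c ≡ ord → ¬ InR D r c → cell T r c ≡ ord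
open Invariant

Invariant-refl : ∀ D → Invariant D D
Invariant-refl D = record
  { stays-occupied = λ _ _ occupied → occupied
  ; new-under-R    = λ _ _ isOrd notOrd → ⊥-elim (notOrd isOrd)
  ; fixed-off-R    = λ _ _ isOrd _ → isOrd
  }

module _ {D T : Diagram} (inv : Invariant D T) where

  EmptyRightOf-transfer : ∀ {r c} → EmptyRightOf T r c → EmptyRightOf D r c
  EmptyRightOf-transfer {r} emptyT c' c<c' with ≟emp (cell D r c')
  ... | yes empty   = empty
  ... | no occupied = ⊥-elim (stays-occupied inv r c' occupied (emptyT c' c<c'))

  InR⇒UnderR : ∀ {r c} → InR T r c → UnderR D r c
  InR⇒UnderR {r} {c} (isOrdT , emptyT) with ≟ord (cell D r c)
  ... | yes isOrd = r , ≤-refl , isOrd , EmptyRightOf-transfer emptyT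
  ... | no notOrd = new-under-R inv r c isOrdT notOrd

  rightmost⇒¬inSᵇ : ∀ {r c} → rightmostCol T r ≡ just c → inSᵇ D r c ≡ false
  rightmost⇒¬inSᵇ {r} {c} rc with ≟ord (cell D r c)
  ... | yes isOrd = UnderR⇒¬inSᵇ
                      (r , ≤-refl , isOrd , EmptyRightOf-transfer (proj₂ (rightmostCol-just T r rc)))
  ... | no notOrd = ≢ord⇒¬inSᵇ D r c notOrd

  f-agrees-under : ∀ {r c} → UnderR D r c → ∀ j → j ≤ r → cell (f D T) j c ≡ cell T j c
  f-agrees-under {c = c} under j j≤r = f-keeps D T j c (UnderR⇒¬inSᵇ (UnderR-mono j≤r under))

  rightmostCol-f : ∀ r → rightmostCol (f D T) r ≡ rightmostCol T r
  rightmostCol-f r =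
    maxUpTo-sub (occupiedIn T) (occupiedIn (f D T)) (bound T) (f-nonempty D T r) λ k rc →
      trans (cong (λ x → not (isEmp x)) (f-keeps D T r k (rightmost⇒¬inSᵇ rc)))
            (proj₁ (maxUpTo-just (occupiedIn T) (bound T) rc))
    where
    occupiedIn : Diagram → ℕ → Bool
    occupiedIn U c = not (isEmp (cell U r c))

  module _ {r c h : ℕ} (inR : InR T r c) (1≤h : 1 ≤ h) (h<r : h < r) where

    private
      source-inside : inBox (bound T) r c ≡ true
      source-inside = nonempty⇒inBox T (≡ord⇒≢emp (proj₁ inR))

      target-inside : inBox (bound T) h c ≡ true
      target-inside with _ , r≤n , 1≤c , c≤n ← cell-bounds T (≡ord⇒≢emp (proj₁ inR)) =
        bounds-inBox 1≤h (≤-trans (<⇒≤ h<r) r≤n) 1≤c c≤n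

      source≢target : (r , c) ≢ (h , c)
      source≢target refl = <-irrefl refl h<r

      target : cell (moveCell T r c h) h c ≡ ord
      target = moveCell-target T r c h target-inside

      source : cell (moveCell T r c h) r c ≡ gho
      source = moveCell-source T r c h source≢target source-inside

    Invariant-moveCell : Invariant D (moveCell T r c h)
    Invariant-moveCell = record
      { stays-occupied = occupied ; new-under-R = under ; fixed-off-R = fixed }
      where
      occupied : ∀ x y → cell D x y ≢ emp → cell (moveCell T r c h) x y ≢ emp
      occupied x y occD with (x , y) ≟₂ (h , c) | (x , y) ≟₂ (r , c)
      ... | yes refl | _        = ≡ord⇒≢emp target
      ... | no _     | yes refl = ≡gho⇒≢emp source
      ... | no ≢t    | no ≢s rewrite moveCell-elsewhere T r c h x y ≢t ≢s = stays-occupied inv x y occD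

      under : ∀ x y → cell (moveCell T r c h) x y ≡ ord → cell D x y ≢ ord → UnderR D x y
      under x y isOrd notOrd with (x , y) ≟₂ (h , c) | (x , y) ≟₂ (r , c)
      ... | yes refl | _        = UnderR-mono (<⇒≤ h<r) (InR⇒UnderR inR)
      ... | no _     | yes refl with () ← trans (sym source) isOrd
      under x y isOrd notOrd | no ≢t | no ≢s =
        new-under-R inv x y (trans (sym (moveCell-elsewhere T r c h x y ≢t ≢s)) isOrd) notOrd

      fixed : ∀ x y → cell D x y ≡ ord → ¬ InR D x y → cell (moveCell T r c h) x y ≡ ord
      fixed x y isOrd ∉R with (x , y) ≟₂ (h , c) | (x , y) ≟₂ (r , c)
      ... | yes refl | _        = target
      ... | no _     | yes refl = ⊥-elim (∉R (isOrd , EmptyRightOf-transfer (proj₂ inR)))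
      ... | no ≢t    | no ≢s rewrite moveCell-elsewhere T r c h x y ≢t ≢s = fixed-off-R inv x y isOrd ∉R

  Invariant-G : ∀ r → Invariant D (G T r)
  Invariant-G r rewrite G≡applyMove T r with moveTarget T r in mt
  ... | nothing      = inv
  ... | just (c , h) with inR , 1≤h , h<r ← moveTarget-just T r mt = Invariant-moveCell inR 1≤h h<r

  moveTarget-f : ∀ r → moveTarget (f D T) r ≡ moveTarget T r
  moveTarget-f r =
    trans (cong (targetIn (f D T) r) (rightmostCol-f r)) (inColumn (rightmostCol T r) refl)
    where
    inColumn : ∀ mc → rightmostCol T r ≡ mc → targetIn (f D T) r mc ≡ targetIn T r mc
    inColumn nothing  _  = refl
    inColumn (just c) rc rewrite f-keeps D T r c (rightmost⇒¬inSᵇ rc)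
      with isGho (cell T r c) in notGho
    ... | true  = refl
    ... | false = targetAt-local (f D T) T r c
                    (f-agrees-under (InR⇒UnderR (rightmost-InR T r rc notGho)))

  applyMove-f : ∀ r → applyMove (f D T) r (moveTarget T r) ≈D f D (applyMove T r (moveTarget T r))
  applyMove-f r with moveTarget T r in mt
  ... | nothing      = λ _ _ → refl
  ... | just (c , h) with inR , _ , h<r ← moveTarget-just T r mt =
    moveCell-f D T r c h (UnderR⇒¬inSᵇ (UnderR-mono (<⇒≤ h<r) under)) (UnderR⇒¬inSᵇ under)
    where
    under : UnderR D r c
    under = InR⇒UnderR inR

  G-f : ∀ r → G (f D T) r ≈D f D (G T r)
  G-f r x y = begin
    cell (G (f D T) r) x y
      ≡⟨ cong (λ U → cell U x y) (G≡applyMove (f D T) r) ⟩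
    cell (applyMove (f D T) r (moveTarget (f D T) r)) x y
      ≡⟨ cong (λ t → cell (applyMove (f D T) r t) x y) (moveTarget-f r) ⟩
    cell (applyMove (f D T) r (moveTarget T r)) x y
      ≡⟨ applyMove-f r x y ⟩
    cell (f D (applyMove T r (moveTarget T r))) x y
      ≡⟨ cong (λ U → cell (f D U) x y) (G≡applyMove T r) ⟨
    cell (f D (G T r)) x y
      ∎
    where open ≡-Reasoning

Invariant-GKD : ∀ {D T} → GKD D T → Invariant D T
Invariant-GKD {D} gkd-base           = Invariant-refl D
Invariant-GKD     (gkd-step reach r) = Invariant-G (Invariant-GKD reach) r

proposition4p9 : (D T : Diagram) → NoGhosts D → GKD D T →
    ((r c : ℕ) → InS D r c → cell T r c ≡ ord)
    × ((r̂ r̃ c : ℕ) → InR T r̂ c → cell T r̃ c ≡ ord → r̃ ≤ r̂ → ¬ InS D r̃ c)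
    × ((r : ℕ) → 0 < r → G (f D T) r ≈D f D (G T r))
proposition4p9 D T _ reachable =
    (λ r c (isOrd , ∉R , _) → fixed-off-R inv r c isOrd ∉R)
  , (λ r̂ r̃ c inR _ r̃≤r̂ → UnderR⇒¬InS (UnderR-mono r̃≤r̂ (InR⇒UnderR inv inR)))
  , (λ r _ → G-f inv r)
  where
  inv : Invariant D T
  inv = Invariant-GKD reachable
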